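{- Let $p$ be a prime and let $\boldsymbol{\alpha}=(\alpha_1,\ldots,\alpha_r)$ be a basis for a finite abelian $p$-group $G$, with $|\alpha_i|=p^{n_i}$. Let $j<k$ be nonnegative integers, and define $q_i=p^{\,j+\max(0,n_i-k)}$ for $1\le i\le r$ and $\boldsymbol{\alpha}(j,k)=(\alpha_1^{q_1},\ldots,\alpha_r^{q_r})$. Then $\boldsymbol{\alpha}(j,k)$ is a basis for the subgroup $$G(j,k)=\{\beta^{p^j}:\ \beta\in G,\ \beta^{p^k}=1_G\}.$$
   Context: Groups are written multiplicatively. A vector $\boldsymbol{\alpha}=(\alpha_1,\ldots,\alpha_r)$ of elements of a finite abelian group is called a basis (for the subgroup $\langle\boldsymbol{\alpha}\rangle$ it generates) if every $\beta\in\langle\boldsymbol{\alpha}\rangle$ can be written uniquely as $\beta=\alpha_1^{x_1}\cdots\alpha_r^{x_r}$ with $0\le x_i<|\alpha_i|$; components equal to the identity are allowed. -}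

module Defs where

open import Level using (_⊔_)
open import Algebra.Bundles using (AbelianGroup)
open import Data.Nat using (ℕ; zero; suc; _≤_; _<_)
open import Data.Fin using (Fin)
import Data.Fin as F
open import Data.Product using (Σ; _×_; ∃)
open import Relation.Binary.PropositionalEquality using (_≡_)
open import Relation.Nullary using (¬_)

module _ {c ℓ} (G : AbelianGroup c ℓ) where
  open AbelianGroup G

  pow : Carrier → ℕ → Carrier
  pow g zero    = ε
  pow g (suc n) = g ∙ pow g n

  prodPow : (r : ℕ) → (Fin r → Carrier) → (Fin r → ℕ) → Carrier
  prodPow zero    α x = ε
  prodPow (suc r) α x = pow (α F.zero) (x F.zero) ∙ prodPow r (λ i → α (F.suc i)) (λ i → x (F.suc i))

  HasOrder : Carrier → ℕ → Set ℓ
  HasOrder g d = (0 < d) × (pow g d ≈ ε) × (∀ m → 0 < m → pow g m ≈ ε → d ≤ m)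

  -- membership in the subgroup ⟨α⟩ generated by α (elements of finite order,
  -- so natural exponents suffice)
  InSpan : (r : ℕ) → (Fin r → Carrier) → Carrier → Set ℓ
  InSpan r α β = Σ (Fin r → ℕ) λ x → β ≈ prodPow r α x

  IsBasis : (r : ℕ) → (Fin r → Carrier) → (Fin r → ℕ) → Set (c ⊔ ℓ)
  IsBasis r α ord =
      (∀ i → HasOrder (α i) (ord i))
    × (∀ β → InSpan r α β → Σ (Fin r → ℕ) λ x → (∀ i → x i < ord i) × (β ≈ prodPow r α x))
    × (∀ x y → (∀ i → x i < ord i) → (∀ i → y i < ord i)
             → prodPow r α x ≈ prodPow r α y → ∀ i → x i ≡ y i)

  IsFinite : Set (c ⊔ ℓ)
  IsFinite = Σ ℕ λ m → Σ (Fin m → Carrier) λ f → ∀ g → ∃ λ i → f i ≈ g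

  InGjk : ℕ → ℕ → ℕ → Carrier → Set (c ⊔ ℓ)
  InGjk p j k β = ∃ λ γ → (pow γ (p Data.Nat.^ k) ≈ ε) × (β ≈ pow γ (p Data.Nat.^ j))

{-# OPTIONS --safe #-}
-- A family α with |α i| = ord i is a basis of its span exactly when it is independent:
-- ∏ α i ^ x i = 1 forces ord i ∣ x i for every i.  Raising α i, of order p ^ n i, to the
-- power p ^ e i yields an element of order p ^ (n i ∸ e i), and independence passes to these
-- powers because p ^ n i ∣ p ^ e i * x forces p ^ (n i ∸ e i) ∣ x.  For γ = ∏ α i ^ x i,
-- independence also shows that γ ^ p ^ k = 1 iff p ^ (n i ∸ k) ∣ x i for all i, and then
-- γ ^ p ^ j is a product of powers of the α i ^ p ^ (j + (n i ∸ k)); conversely each such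
-- product is γ ^ p ^ j for γ = ∏ α i ^ (p ^ (n i ∸ k) * x i).
module Submission where

open import Defs
open import Algebra.Bundles using (AbelianGroup)
open import Data.Nat
  using (ℕ; zero; suc; _+_; _*_; _∸_; _^_; _≤_; _<_; _%_; _/_; NonZero; >-nonZero; z<s; _≤?_)
open import Data.Nat.Primality using (Prime; prime⇒nonZero)
open import Data.Fin using (Fin)
import Data.Fin as F
open import Data.Product using (Σ; _×_; _,_; proj₁; proj₂)

open import Data.Nat.Properties
  using (*-comm; *-assoc; +-identityʳ; ^-distribˡ-+-*; m^n>0; m^n≢0; m∸n+n≡m; m+[n∸m]≡n;
         m≤n+m∸n; m∸n≤m; m<n⇒0<n∸m; m+n≡0⇒n≡0; +-cancelʳ-≡; +-mono-<-≤; m≤m+n; +-monoʳ-≤;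
         <⇒≤; <⇒≱; <⇒≢; ≰⇒>; m≤n⇒m∸n≡0)
open import Data.Nat.DivMod using (m≡m%n+[m/n]*n; m%n<n)
open import Data.Nat.Divisibility
  using (_∣_; divides; divides-refl; m%n≡0⇒n∣m; ∣⇒≤; 1∣_; n∣m*n; ∣m⇒∣m*n; *-cancelˡ-∣)
open import Relation.Binary.PropositionalEquality using (_≡_; cong; subst)
import Relation.Binary.PropositionalEquality as ≡
open import Relation.Nullary using (yes; no; contradiction)

∣+∸⇒≡ : ∀ {o x y} → x < o → y < o → o ∣ x + (o ∸ y) → x ≡ y
∣+∸⇒≡ {o} {x} {y} x<o y<o (divides zero eq) =
  contradiction (≡.sym (m+n≡0⇒n≡0 x eq)) (<⇒≢ (m<n⇒0<n∸m y<o))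
∣+∸⇒≡ {o} {x} {y} x<o y<o (divides (suc zero) eq) = +-cancelʳ-≡ (o ∸ y) x y (begin
  x + (o ∸ y) ≡⟨ eq ⟩
  o + 0       ≡⟨ +-identityʳ o ⟩
  o           ≡⟨ m+[n∸m]≡n (<⇒≤ y<o) ⟨
  y + (o ∸ y) ∎)
  where open ≡.≡-Reasoning
∣+∸⇒≡ {o} {x} {y} x<o y<o (divides (suc (suc q)) eq) =
  contradiction (+-monoʳ-≤ o (m≤m+n o (q * o)))
                (<⇒≱ (subst (_< o + o) eq (+-mono-<-≤ x<o (m∸n≤m o y))))

^-+-*-assoc : ∀ p a b m → p ^ (a + b) * m ≡ p ^ a * (p ^ b * m)
^-+-*-assoc p a b m = ≡.trans (cong (_* m) (^-distribˡ-+-* p a b)) (*-assoc (p ^ a) (p ^ b) m)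

module _ (p : ℕ) where

  ^∣^ : ∀ {a b} → a ≤ b → p ^ a ∣ p ^ b
  ^∣^ {a} {b} a≤b = divides (p ^ (b ∸ a)) (begin
    p ^ b               ≡⟨ cong (p ^_) (m∸n+n≡m a≤b) ⟨
    p ^ (b ∸ a + a)     ≡⟨ ^-distribˡ-+-* p (b ∸ a) a ⟩
    p ^ (b ∸ a) * p ^ a ∎)
    where open ≡.≡-Reasoning

  ^∣^*^∸ : ∀ a e → p ^ a ∣ p ^ e * p ^ (a ∸ e)
  ^∣^*^∸ a e = subst (p ^ a ∣_) (^-distribˡ-+-* p e (a ∸ e)) (^∣^ (m≤n+m∸n a e))

  ^∣^*⇒^∸∣ : .{{_ : NonZero p}} → ∀ a e m → p ^ a ∣ p ^ e * m → p ^ (a ∸ e) ∣ m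
  ^∣^*⇒^∸∣ a e m pᵃ∣pᵉm with a ≤? e
  ... | yes a≤e = subst (λ d → p ^ d ∣ m) (≡.sym (m≤n⇒m∸n≡0 a≤e)) (1∣ m)
  ... | no  a≰e = *-cancelˡ-∣ (p ^ e) {{m^n≢0 p e}} (subst (_∣ p ^ e * m) pᵃ≡pᵉpᵃ⁻ᵉ pᵃ∣pᵉm)
    where
    pᵃ≡pᵉpᵃ⁻ᵉ : p ^ a ≡ p ^ e * p ^ (a ∸ e)
    pᵃ≡pᵉpᵃ⁻ᵉ = ≡.trans (cong (p ^_) (≡.sym (m+[n∸m]≡n (<⇒≤ (≰⇒> a≰e))))) (^-distribˡ-+-* p e (a ∸ e))

module _ {c ℓ} (G : AbelianGroup c ℓ) where
  open AbelianGroup G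
  open import Relation.Binary.Reasoning.Setoid setoid
  open import Algebra.Properties.CommutativeMonoid.Mult commutativeMonoid
    using (×-congʳ; ×-congˡ; ×-homo-+; ×-assocˡ; ×-distrib-+)
    renaming (_×_ to _·_)

  private
    pow≡· : ∀ g n → pow G g n ≡ n · g
    pow≡· g zero    = ≡.refl
    pow≡· g (suc n) = cong (g ∙_) (pow≡· g n)

  pow-cong : ∀ {a b} n → a ≈ b → pow G a n ≈ pow G b n
  pow-cong {a} {b} n a≈b rewrite pow≡· a n | pow≡· b n = ×-congʳ n a≈b

  pow-+ : ∀ g m n → pow G g (m + n) ≈ pow G g m ∙ pow G g n
  pow-+ g m n rewrite pow≡· g (m + n) | pow≡· g m | pow≡· g n = ×-homo-+ g m n

  pow-* : ∀ g m n → pow G (pow G g m) n ≈ pow G g (m * n)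
  pow-* g m n rewrite pow≡· (pow G g m) n | pow≡· g m | pow≡· g (m * n) =
    trans (×-assocˡ g n m) (×-congˡ (*-comm n m))

  pow-∙ : ∀ a b n → pow G (a ∙ b) n ≈ pow G a n ∙ pow G b n
  pow-∙ a b n rewrite pow≡· (a ∙ b) n | pow≡· a n | pow≡· b n = ×-distrib-+ a b n

  pow-ε : ∀ n → pow G ε n ≈ ε
  pow-ε zero    = refl
  pow-ε (suc n) = trans (identityˡ _) (pow-ε n)

  ∣⇒pow≈ε : ∀ {g d m} → pow G g d ≈ ε → d ∣ m → pow G g m ≈ ε
  ∣⇒pow≈ε {g} {d} gᵈ≈ε (divides-refl q) = begin
    pow G g (q * d)     ≡⟨ cong (pow G g) (*-comm q d) ⟩
    pow G g (d * q)     ≈⟨ sym (pow-* g d q) ⟩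
    pow G (pow G g d) q ≈⟨ pow-cong q gᵈ≈ε ⟩
    pow G ε q           ≈⟨ pow-ε q ⟩
    ε                   ∎

  pow-% : ∀ g d .{{_ : NonZero d}} → pow G g d ≈ ε → ∀ m → pow G g m ≈ pow G g (m % d)
  pow-% g d gᵈ≈ε m = begin
    pow G g m                                 ≡⟨ cong (pow G g) (m≡m%n+[m/n]*n m d) ⟩
    pow G g (m % d + m / d * d)               ≈⟨ pow-+ g (m % d) (m / d * d) ⟩
    pow G g (m % d) ∙ pow G g (m / d * d)     ≈⟨ ∙-congˡ (∣⇒pow≈ε gᵈ≈ε (n∣m*n (m / d))) ⟩
    pow G g (m % d) ∙ ε                       ≈⟨ identityʳ _ ⟩
    pow G g (m % d)                           ∎

  HasOrder⇒∣ : ∀ {g d m} → HasOrder G g d → pow G g m ≈ ε → d ∣ m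
  HasOrder⇒∣ {g} {d} {m} (d>0 , gᵈ≈ε , minimal) gᵐ≈ε =
    m%n≡0⇒n∣m m d (below-order≡0 (m%n<n m d) (trans (sym (pow-% g d gᵈ≈ε m)) gᵐ≈ε))
    where
    instance _ = >-nonZero d>0
    below-order≡0 : ∀ {s} → s < d → pow G g s ≈ ε → s ≡ 0
    below-order≡0 {zero}  _   _    = ≡.refl
    below-order≡0 {suc s} s<d gˢ≈ε = contradiction (minimal (suc s) z<s gˢ≈ε) (<⇒≱ s<d)

  pow-reduce : ∀ {g d} → HasOrder G g d → ∀ m → Σ ℕ λ s → s < d × pow G g m ≈ pow G g s
  pow-reduce {g} {d} (d>0 , gᵈ≈ε , _) m = m % d , m%n<n m d , pow-% g d gᵈ≈ε m
    where instance _ = >-nonZero d>0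

  prodPow-cong : ∀ r {α β : Fin r → Carrier} {x y : Fin r → ℕ} →
                 (∀ i → pow G (α i) (x i) ≈ pow G (β i) (y i)) →
                 prodPow G r α x ≈ prodPow G r β y
  prodPow-cong zero    eq = refl
  prodPow-cong (suc r) eq = ∙-cong (eq F.zero) (prodPow-cong r (λ i → eq (F.suc i)))

  prodPow-ε : ∀ r {α : Fin r → Carrier} {x : Fin r → ℕ} →
              (∀ i → pow G (α i) (x i) ≈ ε) → prodPow G r α x ≈ ε
  prodPow-ε zero    eq = refl
  prodPow-ε (suc r) eq = trans (∙-cong (eq F.zero) (prodPow-ε r (λ i → eq (F.suc i)))) (identityˡ ε)

  prodPow-cong-≗ : ∀ r {α : Fin r → Carrier} {x y : Fin r → ℕ} →
                   (∀ i → x i ≡ y i) → prodPow G r α x ≈ prodPow G r α y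
  prodPow-cong-≗ r {α} x≗y = prodPow-cong r (λ i → reflexive (cong (pow G (α i)) (x≗y i)))

  prodPow-+ : ∀ r (α : Fin r → Carrier) (x y : Fin r → ℕ) →
              prodPow G r α (λ i → x i + y i) ≈ prodPow G r α x ∙ prodPow G r α y
  prodPow-+ zero    α x y = sym (identityˡ ε)
  prodPow-+ (suc r) α x y = begin
    pow G (α F.zero) (x F.zero + y F.zero) ∙ prodPow G r α′ (λ i → x′ i + y′ i)
      ≈⟨ ∙-cong (pow-+ (α F.zero) (x F.zero) (y F.zero)) (prodPow-+ r α′ x′ y′) ⟩
    (pow G (α F.zero) (x F.zero) ∙ pow G (α F.zero) (y F.zero)) ∙ (prodPow G r α′ x′ ∙ prodPow G r α′ y′)
      ≈⟨ interchange _ _ _ _ ⟩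
    prodPow G (suc r) α x ∙ prodPow G (suc r) α y
      ∎
    where
    open import Algebra.Properties.CommutativeSemigroup commutativeSemigroup using (interchange)
    α′ : Fin r → Carrier
    α′ i = α (F.suc i)
    x′ y′ : Fin r → ℕ
    x′ i = x (F.suc i)
    y′ i = y (F.suc i)

  pow-prodPow : ∀ r (α : Fin r → Carrier) (x : Fin r → ℕ) m →
                pow G (prodPow G r α x) m ≈ prodPow G r α (λ i → m * x i)
  pow-prodPow zero    α x m = pow-ε m
  pow-prodPow (suc r) α x m = begin
    pow G (pow G (α F.zero) (x F.zero) ∙ prodPow G r α′ x′) m
      ≈⟨ pow-∙ _ _ m ⟩
    pow G (pow G (α F.zero) (x F.zero)) m ∙ pow G (prodPow G r α′ x′) m
      ≈⟨ ∙-cong (pow-* (α F.zero) (x F.zero) m) (pow-prodPow r α′ x′ m) ⟩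
    pow G (α F.zero) (x F.zero * m) ∙ prodPow G r α′ (λ i → m * x′ i)
      ≡⟨ cong (λ e → pow G (α F.zero) e ∙ prodPow G r α′ (λ i → m * x′ i)) (*-comm (x F.zero) m) ⟩
    prodPow G (suc r) α (λ i → m * x i)
      ∎
    where
    α′ : Fin r → Carrier
    α′ i = α (F.suc i)
    x′ : Fin r → ℕ
    x′ i = x (F.suc i)

  prodPow-pow : ∀ r (α : Fin r → Carrier) (q x : Fin r → ℕ) →
                prodPow G r (λ i → pow G (α i) (q i)) x ≈ prodPow G r α (λ i → q i * x i)
  prodPow-pow r α q x = prodPow-cong r (λ i → pow-* (α i) (q i) (x i))

  reduce-exponents : ∀ {r} {α : Fin r → Carrier} {ord : Fin r → ℕ} →
    (∀ i → HasOrder G (α i) (ord i)) → (x : Fin r → ℕ) →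
    Σ (Fin r → ℕ) λ y → (∀ i → y i < ord i) × (∀ i → pow G (α i) (x i) ≈ pow G (α i) (y i))
  reduce-exponents {α = α} {ord} hasOrder x =
    (λ i → proj₁ (reduced i)) , (λ i → proj₁ (proj₂ (reduced i))) , (λ i → proj₂ (proj₂ (reduced i)))
    where
    reduced : ∀ i → Σ ℕ λ s → s < ord i × pow G (α i) (x i) ≈ pow G (α i) s
    reduced i = pow-reduce (hasOrder i) (x i)

  IsIndependent : (r : ℕ) → (Fin r → Carrier) → (Fin r → ℕ) → Set ℓ
  IsIndependent r α ord = ∀ x → prodPow G r α x ≈ ε → ∀ i → ord i ∣ x i

  IsBasis⇒IsIndependent : ∀ {r α ord} → IsBasis G r α ord → IsIndependent r α ord
  IsBasis⇒IsIndependent {r} {α} (hasOrder , _ , unique) x αˣ≈ε i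
    with reduce-exponents hasOrder x
  ... | y , y<ord , αˣ≈αʸ = HasOrder⇒∣ (hasOrder i) (begin
    pow G (α i) (x i) ≈⟨ αˣ≈αʸ i ⟩
    pow G (α i) (y i) ≡⟨ cong (pow G (α i)) (y≡0 i) ⟩
    ε                 ∎)
    where
    y≡0 : ∀ i → y i ≡ 0
    y≡0 = unique y (λ _ → 0) y<ord (λ i → proj₁ (hasOrder i)) (begin
      prodPow G r α y          ≈⟨ prodPow-cong r αˣ≈αʸ ⟨
      prodPow G r α x          ≈⟨ αˣ≈ε ⟩
      ε                        ≈⟨ prodPow-ε r (λ _ → refl) ⟨
      prodPow G r α (λ _ → 0)  ∎)

  IsIndependent⇒IsBasis : ∀ {r} {α : Fin r → Carrier} {ord : Fin r → ℕ} →
    (∀ i → HasOrder G (α i) (ord i)) → IsIndependent r α ord → IsBasis G r α ord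
  IsIndependent⇒IsBasis {r} {α} {ord} hasOrder independent = hasOrder , reduce , unique
    where
    reduce : ∀ β → InSpan G r α β → Σ (Fin r → ℕ) λ y → (∀ i → y i < ord i) × (β ≈ prodPow G r α y)
    reduce β (x , β≈αˣ) with reduce-exponents hasOrder x
    ... | y , y<ord , αˣ≈αʸ = y , y<ord , trans β≈αˣ (prodPow-cong r αˣ≈αʸ)

    unique : ∀ x y → (∀ i → x i < ord i) → (∀ i → y i < ord i) →
             prodPow G r α x ≈ prodPow G r α y → ∀ i → x i ≡ y i
    -- Without subtraction on ℕ, x + (ord ∸ y) plays the role of x − y (they agree modulo ord).
    unique x y x<ord y<ord αˣ≈αʸ i = ∣+∸⇒≡ (x<ord i) (y<ord i) (independent (λ i → x i + z i) αˣ⁺ᶻ≈ε i)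
      where
      z : Fin r → ℕ
      z i = ord i ∸ y i
      αʸ⁺ᶻ≈ε : ∀ i → pow G (α i) (y i + z i) ≈ ε
      αʸ⁺ᶻ≈ε i = trans (reflexive (cong (pow G (α i)) (m+[n∸m]≡n (<⇒≤ (y<ord i)))))
                       (proj₁ (proj₂ (hasOrder i)))
      αˣ⁺ᶻ≈ε : prodPow G r α (λ i → x i + z i) ≈ ε
      αˣ⁺ᶻ≈ε = begin
        prodPow G r α (λ i → x i + z i)     ≈⟨ prodPow-+ r α x z ⟩
        prodPow G r α x ∙ prodPow G r α z   ≈⟨ ∙-congʳ αˣ≈αʸ ⟩
        prodPow G r α y ∙ prodPow G r α z   ≈⟨ prodPow-+ r α y z ⟨
        prodPow G r α (λ i → y i + z i)     ≈⟨ prodPow-ε r αʸ⁺ᶻ≈ε ⟩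
        ε                                   ∎

module _ {c ℓ} (G : AbelianGroup c ℓ) (p : ℕ) .{{_ : NonZero p}} where
  open AbelianGroup G
  open import Relation.Binary.Reasoning.Setoid setoid

  HasOrder-pow : ∀ {g n} e → HasOrder G g (p ^ n) → HasOrder G (pow G g (p ^ e)) (p ^ (n ∸ e))
  HasOrder-pow {g} {n} e hasOrder@(_ , gᵖⁿ≈ε , _) =
    m^n>0 p (n ∸ e) ,
    trans (pow-* G g (p ^ e) (p ^ (n ∸ e))) (∣⇒pow≈ε G gᵖⁿ≈ε (^∣^*^∸ p n e)) ,
    λ m m>0 gᵖᵉᵐ≈ε → ∣⇒≤ {{>-nonZero m>0}}
      (^∣^*⇒^∸∣ p n e m (HasOrder⇒∣ G hasOrder (trans (sym (pow-* G g (p ^ e) m)) gᵖᵉᵐ≈ε)))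

  IsIndependent-pow : ∀ {r} {α : Fin r → Carrier} {n : Fin r → ℕ} (e : Fin r → ℕ) →
    IsIndependent G r α (λ i → p ^ n i) →
    IsIndependent G r (λ i → pow G (α i) (p ^ e i)) (λ i → p ^ (n i ∸ e i))
  IsIndependent-pow {r} {α} {n} e independent x αᵖᵉˣ≈ε i =
    ^∣^*⇒^∸∣ p (n i) (e i) (x i)
      (independent (λ i → p ^ e i * x i) (trans (sym (prodPow-pow G r α (λ i → p ^ e i) x)) αᵖᵉˣ≈ε) i)

  generatorsOfGjk : ∀ {r} → (Fin r → Carrier) → (Fin r → ℕ) → ℕ → ℕ → Fin r → Carrier
  generatorsOfGjk α n j k i = pow G (α i) (p ^ (j + (n i ∸ k)))

  span⊆Gjk : ∀ {r} {α : Fin r → Carrier} {n : Fin r → ℕ} j k →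
    (∀ i → pow G (α i) (p ^ n i) ≈ ε) →
    ∀ {β} → InSpan G r (generatorsOfGjk α n j k) β → InGjk G p j k β
  span⊆Gjk {r} {α} {n} j k αᵖⁿ≈ε {β} (x , β≈αʲᵏˣ) = γ , γᵖᵏ≈ε , β≈γᵖʲ
    where
    y : Fin r → ℕ
    y i = p ^ (n i ∸ k) * x i
    γ : Carrier
    γ = prodPow G r α y
    pⁿ∣pᵏy : ∀ i → p ^ n i ∣ p ^ k * y i
    pⁿ∣pᵏy i = subst (p ^ n i ∣_) (*-assoc (p ^ k) (p ^ (n i ∸ k)) (x i))
                     (∣m⇒∣m*n (x i) (^∣^*^∸ p (n i) k))
    γᵖᵏ≈ε : pow G γ (p ^ k) ≈ ε
    γᵖᵏ≈ε = begin
      pow G γ (p ^ k)                     ≈⟨ pow-prodPow G r α y (p ^ k) ⟩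
      prodPow G r α (λ i → p ^ k * y i)   ≈⟨ prodPow-ε G r (λ i → ∣⇒pow≈ε G (αᵖⁿ≈ε i) (pⁿ∣pᵏy i)) ⟩
      ε                                   ∎
    β≈γᵖʲ : β ≈ pow G γ (p ^ j)
    β≈γᵖʲ = begin
      β                                                 ≈⟨ β≈αʲᵏˣ ⟩
      prodPow G r (generatorsOfGjk α n j k) x           ≈⟨ prodPow-pow G r α (λ i → p ^ (j + (n i ∸ k))) x ⟩
      prodPow G r α (λ i → p ^ (j + (n i ∸ k)) * x i)   ≈⟨ prodPow-cong-≗ G r (λ i → ^-+-*-assoc p j (n i ∸ k) (x i)) ⟩
      prodPow G r α (λ i → p ^ j * y i)                 ≈⟨ pow-prodPow G r α y (p ^ j) ⟨
      pow G γ (p ^ j)                                   ∎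

  Gjk⊆span : ∀ {r} {α : Fin r → Carrier} {n : Fin r → ℕ} j k →
    IsIndependent G r α (λ i → p ^ n i) → (∀ γ → InSpan G r α γ) →
    ∀ {β} → InGjk G p j k β → InSpan G r (generatorsOfGjk α n j k) β
  Gjk⊆span {r} {α} {n} j k independent spans {β} (γ , γᵖᵏ≈ε , β≈γᵖʲ) with spans γ
  ... | x , γ≈αˣ = y , β≈αʲᵏʸ
    where
    αᵖᵏˣ≈ε : prodPow G r α (λ i → p ^ k * x i) ≈ ε
    αᵖᵏˣ≈ε = begin
      prodPow G r α (λ i → p ^ k * x i) ≈⟨ pow-prodPow G r α x (p ^ k) ⟨
      pow G (prodPow G r α x) (p ^ k)   ≈⟨ pow-cong G (p ^ k) γ≈αˣ ⟨
      pow G γ (p ^ k)                   ≈⟨ γᵖᵏ≈ε ⟩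
      ε                                 ∎
    pⁿ⁻ᵏ∣x : ∀ i → p ^ (n i ∸ k) ∣ x i
    pⁿ⁻ᵏ∣x i = ^∣^*⇒^∸∣ p (n i) k (x i) (independent (λ i → p ^ k * x i) αᵖᵏˣ≈ε i)
    y : Fin r → ℕ
    y i = _∣_.quotient (pⁿ⁻ᵏ∣x i)
    pʲx≡pʲ⁺⁽ⁿ⁻ᵏ⁾y : ∀ i → p ^ j * x i ≡ p ^ (j + (n i ∸ k)) * y i
    pʲx≡pʲ⁺⁽ⁿ⁻ᵏ⁾y i =
      ≡.trans (cong (p ^ j *_) (≡.trans (_∣_.equality (pⁿ⁻ᵏ∣x i)) (*-comm (y i) (p ^ (n i ∸ k)))))
              (≡.sym (^-+-*-assoc p j (n i ∸ k) (y i)))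
    β≈αʲᵏʸ : β ≈ prodPow G r (generatorsOfGjk α n j k) y
    β≈αʲᵏʸ = begin
      β                                                 ≈⟨ β≈γᵖʲ ⟩
      pow G γ (p ^ j)                                   ≈⟨ pow-cong G (p ^ j) γ≈αˣ ⟩
      pow G (prodPow G r α x) (p ^ j)                   ≈⟨ pow-prodPow G r α x (p ^ j) ⟩
      prodPow G r α (λ i → p ^ j * x i)                 ≈⟨ prodPow-cong-≗ G r pʲx≡pʲ⁺⁽ⁿ⁻ᵏ⁾y ⟩
      prodPow G r α (λ i → p ^ (j + (n i ∸ k)) * y i)   ≈⟨ prodPow-pow G r α (λ i → p ^ (j + (n i ∸ k))) y ⟨
      prodPow G r (generatorsOfGjk α n j k) y           ∎

lemma1 : ∀ {c ℓ} (G : AbelianGroup c ℓ) (p : ℕ) → Prime p → IsFinite G →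
    (r : ℕ) (α : Fin r → AbelianGroup.Carrier G) (n : Fin r → ℕ) →
    IsBasis G r α (λ i → p ^ n i) → (∀ β → InSpan G r α β) →
    (j k : ℕ) → j < k →
    (∀ β → (InSpan G r (λ i → pow G (α i) (p ^ (j + (n i ∸ k)))) β → InGjk G p j k β)
         × (InGjk G p j k β → InSpan G r (λ i → pow G (α i) (p ^ (j + (n i ∸ k)))) β))
    × Σ (Fin r → ℕ) (λ ord → IsBasis G r (λ i → pow G (α i) (p ^ (j + (n i ∸ k)))) ord)
lemma1 G p p-prime _ r α n basis@(hasOrder , _ , _) spans j k _ =
  (λ β → span⊆Gjk G p j k (λ i → proj₁ (proj₂ (hasOrder i))) , Gjk⊆span G p j k independent spans) ,
  (λ i → p ^ (n i ∸ e i)) ,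
  IsIndependent⇒IsBasis G (λ i → HasOrder-pow G p (e i) (hasOrder i))
                          (IsIndependent-pow G p e independent)
  where
  instance _ = prime⇒nonZero p-prime
  e : Fin r → ℕ
  e i = j + (n i ∸ k)
  independent : IsIndependent G r α (λ i → p ^ n i)
  independent = IsBasis⇒IsIndependent G basis
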